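{- Let $X$ be a finite totally ordered alphabet. The map $\phi_X$ is a bijection between the elements of the free tree monoid $\operatorname{FT}(X)$ (identified with their reduced words) and the set $T_{|X|}$ of trees.
   Context: $\operatorname{FT}(X)$ is generated by $X$ subject to $x^2=x$ ($x\in X$) and $yxy=yx$ ($x<y$). Each element has a unique reduced word, where reduced words are characterized recursively: if $y$ is the largest letter of $X$, a word $u$ is reduced iff either $u$ does not contain $y$ and is reduced over $X\setminus\{y\}$, or $u$ contains exactly one $y$ and $u=vyw$ with $v,w$ reduced over $X\setminus\{y\}$. $T_n$ is the set of ordered unlabelled trees whose nodes have out-degree $0$, $1$ or $2$, all leaves are at level $0$ and the root is at level $n$. The map $\phi_X$ from reduced words to trees is defined recursively: if $X=\emptyset$, $\phi_X(\text{empty word})$ is the single-leaf tree in $T_0$. Otherwise let $x$ be the largest letter of $X$: if $u=vxw$ with $v,w$ over $X\setminus\{x\}$, then $\phi_X(u)$ is the tree whose root has the two subtrees $\phi_{X\setminus\{x\}}(v)$ and $\phi_{X\setminus\{x\}}(w)$ in this order; if $x$ does not occur in $u$, $\phi_X(u)$ is the tree whose root has the single subtree $\phi_{X\setminus\{x\}}(u)$. -}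

module Defs where

open import Data.Nat using (ℕ; zero; suc)
open import Data.Fin using (Fin; inject₁; fromℕ)
open import Data.List using (List; []; _∷_; map; _++_)
open import Data.Product using (Σ; _,_)

-- The finite totally ordered alphabet X with |X| = n is modelled as Fin n
-- with its standard order; the largest letter of Fin (suc n) is fromℕ n and
-- X \ {largest} is Fin n embedded via inject₁.

-- Reduced words over Fin n, following the recursive characterisation:
-- u is reduced over Fin (suc n) iff either it avoids the largest letter and is
-- reduced over Fin n, or u = v y w with y the largest letter and v, w reduced
-- over Fin n.
data Reduced : (n : ℕ) → List (Fin n) → Set where
  empty : Reduced zero []
  avoid : ∀ {n} {v : List (Fin n)} → Reduced n v → Reduced (suc n) (map inject₁ v)
  split : ∀ {n} {v w : List (Fin n)} → Reduced n v → Reduced n w →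
          Reduced (suc n) (map inject₁ v ++ fromℕ n ∷ map inject₁ w)

FT : ℕ → Set
FT n = Σ (List (Fin n)) (Reduced n)

-- T n : ordered unlabelled trees, out-degrees 0,1,2, all leaves at level 0,
-- root at level n.
data T : ℕ → Set where
  leaf   : T zero
  unary  : ∀ {n} → T n → T (suc n)
  binary : ∀ {n} → T n → T n → T (suc n)

φ-red : ∀ {n} {u : List (Fin n)} → Reduced n u → T n
φ-red empty       = leaf
φ-red (avoid r)   = unary (φ-red r)
φ-red (split r s) = binary (φ-red r) (φ-red s)

φ : ∀ {n} → FT n → T n
φ (_ , r) = φ-red r

module Submission where

open import Defs
open import Data.Nat using (ℕ; suc)
open import Data.List using ([]; _∷_; map; _++_)
open import Data.Fin using (inject₁; fromℕ)
open import Data.Product using (_,_)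
open import Relation.Binary.PropositionalEquality using (_≡_; refl; cong; cong₂)
open import Function.Definitions using (Bijective; StrictlyInverseˡ; StrictlyInverseʳ)
open import Function.Consequences.Propositional
  using (inverseᵇ⇒bijective; strictlyInverseˡ⇒inverseˡ; strictlyInverseʳ⇒inverseʳ)

avoidᶠ : ∀ {n} → FT n → FT (suc n)
avoidᶠ (v , r) = map inject₁ v , avoid r

splitᶠ : ∀ {n} → FT n → FT n → FT (suc n)
splitᶠ (v , r) (w , s) = map inject₁ v ++ fromℕ _ ∷ map inject₁ w , split r s

φ⁻¹ : ∀ {n} → T n → FT n
φ⁻¹ leaf         = [] , empty
φ⁻¹ (unary t)    = avoidᶠ (φ⁻¹ t)
φ⁻¹ (binary t s) = splitᶠ (φ⁻¹ t) (φ⁻¹ s)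

φ∘φ⁻¹ : ∀ {n} → StrictlyInverseˡ _≡_ (φ {n}) φ⁻¹
φ∘φ⁻¹ leaf         = refl
φ∘φ⁻¹ (unary t)    = cong unary (φ∘φ⁻¹ t)
φ∘φ⁻¹ (binary t s) = cong₂ binary (φ∘φ⁻¹ t) (φ∘φ⁻¹ s)

φ⁻¹∘φ-red : ∀ {n u} (r : Reduced n u) → φ⁻¹ (φ-red r) ≡ (u , r)
φ⁻¹∘φ-red empty       = refl
φ⁻¹∘φ-red (avoid r)   = cong avoidᶠ (φ⁻¹∘φ-red r)
φ⁻¹∘φ-red (split r s) = cong₂ splitᶠ (φ⁻¹∘φ-red r) (φ⁻¹∘φ-red s)

φ⁻¹∘φ : ∀ {n} → StrictlyInverseʳ _≡_ (φ {n}) φ⁻¹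
φ⁻¹∘φ (_ , r) = φ⁻¹∘φ-red r

proposition5p5 : (n : ℕ) → Bijective {A = FT n} {B = T n} _≡_ _≡_ φ
proposition5p5 n = inverseᵇ⇒bijective
  ( strictlyInverseˡ⇒inverseˡ φ φ∘φ⁻¹
  , strictlyInverseʳ⇒inverseʳ φ φ⁻¹∘φ )
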